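{- Let $(\mathcal{A},\Omega,\Diamond,\mathcal{S})$ be a monadic core. Then in the induced evidenced frame $(\Omega^{\mathcal{A}},\mathcal{S},\cdot\xrightarrow{\cdot}\cdot)$, where $\phi_1\xrightarrow{e}\phi_2:=\forall c\in\mathcal{A}.\ \phi_1(c)\le\Diamond(e\cdot c)(\phi_2)$, there exists evidence $e\in\mathcal{S}$ with $\top\xrightarrow{e}\bot$ if and only if $\mathbf{1}\le\mathbf{0}$ in $\Omega$, where $\top:=\lambda c.\mathbf{1}$ and $\bot:=\lambda c.\mathbf{0}$.
   Context: $M$ is a monad on $\mathbf{Set}$ with unit $\eta$. $\mathcal{A}$ is a monadic combinatory algebra over $M$ (codes with application $\mathcal{A}\times\mathcal{A}\to M\mathcal{A}$ and abstraction codes $\langle\lambda^n.e\rangle$ satisfying combinatory completeness; in particular $\langle\lambda^0.0\rangle\cdot c=\eta(c)$). $(\Omega,\le)$ is a complete Heyting prealgebra with meets $\bigwedge$ (infima), top $\mathbf{1}$, bottom $\mathbf{0}$ and implication $\Rightarrow$. $\Diamond$ is an $M$-modality: natural transformation $\Diamond_X:M(X)\to(X\to\Omega)\to\Omega$ with $\phi(a)\le\Diamond(\eta(a))(\phi)$, $\Diamond(m)(\lambda x.\Diamond(f(x))(\phi))\le\Diamond(\mathrm{bind}(m,f))(\phi)$, and $\bigwedge_c(\phi_1(c)\Rightarrow\phi_2(c))\le\Diamond(m)(\phi_1)\Rightarrow\Diamond(m)(\phi_2)$. $\mathcal{S}\subseteq\mathcal{A}$ is a separator: a combinatorially complete subset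 such that for all $c_f,c_a\in\mathcal{S}$, the progress property $\Diamond(c_f\cdot c_a)(\lambda r.\mathbf{0})\le\mathbf{0}$ holds. -}

module Defs where

open import Data.Nat using (ℕ; zero; suc)
open import Data.Fin using (Fin; zero; suc)
open import Data.Bool using (Bool)
open import Data.Product using (_×_; Σ)
open import Function.Bundles using (_⇔_)
open import Relation.Binary.PropositionalEquality using (_≡_)

record Monad : Set₁ where
  field
    M     : Set → Set
    η     : {X : Set} → X → M X
    bind  : {X Y : Set} → M X → (X → M Y) → M Y
    bind-η-left  : {X Y : Set} (x : X) (f : X → M Y) → bind (η x) f ≡ f x
    bind-η-right : {X : Set} (m : M X) → bind m η ≡ m
    bind-assoc   : {X Y Z : Set} (m : M X) (f : X → M Y) (g : Y → M Z) →
                   bind (bind m f) g ≡ bind m (λ x → bind (f x) g)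

  fmap : {X Y : Set} → (X → Y) → M X → M Y
  fmap f m = bind m (λ x → η (f x))

data Expr (A : Set) (n : ℕ) : Set where
  var  : Fin n → Expr A n
  code : A → Expr A n
  app  : Expr A n → Expr A n → Expr A n

subst0 : {A : Set} {n : ℕ} → Expr A (suc n) → A → Expr A n
subst0 (var zero)    c = code c
subst0 (var (suc i)) c = var i
subst0 (code a)      c = code a
subst0 (app e₁ e₂)   c = app (subst0 e₁ c) (subst0 e₂ c)

eval : (Mo : Monad) {A : Set} → (A → A → Monad.M Mo A) → Expr A 0 → Monad.M Mo A
eval Mo ap (var ())
eval Mo ap (code a)    = Monad.η Mo a
eval Mo ap (app e₁ e₂) =
  Monad.bind Mo (eval Mo ap e₁) (λ f → Monad.bind Mo (eval Mo ap e₂) (λ a → ap f a))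

-- Monadic combinatory algebra over a monad.
-- lam n e = ⟨λ^n.e⟩ for e with n+1 free variables (variable 0 bound first).

record MCA (Mo : Monad) : Set₁ where
  open Monad Mo
  field
    A   : Set
    _·_ : A → A → M A
    lam : (n : ℕ) → Expr A (suc n) → A
    lam-zero : (e : Expr A 1) (c : A) → lam zero e · c ≡ eval Mo _·_ (subst0 e c)
    lam-suc  : (n : ℕ) (e : Expr A (suc (suc n))) (c : A) →
               lam (suc n) e · c ≡ η (lam n (subst0 e c))

record CompleteHeytingPrealgebra : Set₂ where
  infix 4 _≤_
  field
    Ω     : Set₁
    _≤_   : Ω → Ω → Set
    ≤-refl  : {a : Ω} → a ≤ a
    ≤-trans : {a b c : Ω} → a ≤ b → b ≤ c → a ≤ c
    ⋀     : {I : Set} → (I → Ω) → Ω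
    ⋀-lb  : {I : Set} (f : I → Ω) (i : I) → ⋀ f ≤ f i
    ⋀-glb : {I : Set} (f : I → Ω) (a : Ω) → ((i : I) → a ≤ f i) → a ≤ ⋀ f
    𝟏     : Ω
    𝟏-top : (a : Ω) → a ≤ 𝟏
    𝟎     : Ω
    𝟎-bot : (a : Ω) → 𝟎 ≤ a
    _∧_   : Ω → Ω → Ω
    ∧-lbˡ : (a b : Ω) → a ∧ b ≤ a
    ∧-lbʳ : (a b : Ω) → a ∧ b ≤ b
    ∧-glb : (a b c : Ω) → c ≤ a → c ≤ b → c ≤ a ∧ b
    _⇒_   : Ω → Ω → Ω
    ⇒-adj : (a b c : Ω) → (a ∧ b ≤ c) ⇔ (a ≤ b ⇒ c)

record Modality (Mo : Monad) (H : CompleteHeytingPrealgebra) : Set₂ where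
  open Monad Mo
  open CompleteHeytingPrealgebra H
  field
    ◇ : {X : Set} → M X → (X → Ω) → Ω
    ◇-natural : {X Y : Set} (f : X → Y) (m : M X) (φ : Y → Ω) →
                ◇ (fmap f m) φ ≡ ◇ m (λ x → φ (f x))
    ◇-η    : {X : Set} (a : X) (φ : X → Ω) → φ a ≤ ◇ (η a) φ
    ◇-bind : {X Y : Set} (m : M X) (f : X → M Y) (φ : Y → Ω) →
             ◇ m (λ x → ◇ (f x) φ) ≤ ◇ (bind m f) φ
    ◇-mono : {X : Set} (m : M X) (φ₁ φ₂ : X → Ω) →
             ⋀ (λ (c : X) → φ₁ c ⇒ φ₂ c) ≤ (◇ m φ₁ ⇒ ◇ m φ₂)

data AllCodes {A : Set} (P : A → Set) {n : ℕ} : Expr A n → Set where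
  var  : (i : Fin n) → AllCodes P (var i)
  code : (a : A) → P a → AllCodes P (code a)
  app  : {e₁ e₂ : Expr A n} → AllCodes P e₁ → AllCodes P e₂ → AllCodes P (app e₁ e₂)

record Separator {Mo : Monad} (𝒜 : MCA Mo) {H : CompleteHeytingPrealgebra}
                 (D : Modality Mo H) : Set₁ where
  open MCA 𝒜
  open CompleteHeytingPrealgebra H
  open Modality D
  field
    S : A → Set
    comb-complete : (n : ℕ) (e : Expr A (suc n)) → AllCodes S e → S (lam n e)
    progress : (cf ca : A) → S cf → S ca → ◇ (cf · ca) (λ r → 𝟎) ≤ 𝟎

module EvidencedFrame {Mo : Monad} (𝒜 : MCA Mo) {H : CompleteHeytingPrealgebra}
                      (D : Modality Mo H) where
  open MCA 𝒜
  open CompleteHeytingPrealgebra H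
  open Modality D

  Pred : Set₁
  Pred = A → Ω

  _─[_]→_ : Pred → A → Pred → Set
  φ₁ ─[ e ]→ φ₂ = (c : A) → φ₁ c ≤ ◇ (e · c) φ₂

  ⊤ₚ : Pred
  ⊤ₚ = λ c → 𝟏

  ⊥ₚ : Pred
  ⊥ₚ = λ c → 𝟎

{-# OPTIONS --safe #-}
module Submission where

open import Defs
open import Data.Fin using (zero)
open import Data.Nat using (zero)
open import Data.Product using (Σ; _×_; _,_)
open import Function.Bundles using (_⇔_; mk⇔)

-- Evidence e ∈ S for ⊤ → ⊥ can be applied to itself; progress of e · e then
-- forces 𝟏 ≤ 𝟎. Conversely, if 𝟏 ≤ 𝟎 then every predicate entails every other,
-- so the identity combinator ⟨λ⁰.0⟩ ∈ S is evidence for ⊤ → ⊥.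

module _ {Mo : Monad} (𝒜 : MCA Mo) {H : CompleteHeytingPrealgebra} (D : Modality Mo H) where
  open MCA 𝒜
  open CompleteHeytingPrealgebra H
  open EvidencedFrame 𝒜 D

  inconsistent⇒─→ : 𝟏 ≤ 𝟎 → (φ₁ : Pred) (e : A) (φ₂ : Pred) → φ₁ ─[ e ]→ φ₂
  inconsistent⇒─→ 𝟏≤𝟎 φ₁ e φ₂ c = ≤-trans (𝟏-top (φ₁ c)) (≤-trans 𝟏≤𝟎 (𝟎-bot _))

  module _ (Sep : Separator 𝒜 D) where
    open Separator Sep

    S-identity : S (lam zero (var zero))
    S-identity = comb-complete zero (var zero) (var zero)

    ─→⊥ₚ-refutes : {φ : Pred} {e c : A} → S e → S c → φ ─[ e ]→ ⊥ₚ → φ c ≤ 𝟎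
    ─→⊥ₚ-refutes {c = c} Se Sc φ→⊥ = ≤-trans (φ→⊥ c) (progress _ c Se Sc)

theorem3 : (Mo : Monad) (𝒜 : MCA Mo) (H : CompleteHeytingPrealgebra) (D : Modality Mo H) (Sep : Separator 𝒜 D) →
    (Σ (MCA.A 𝒜) (λ e → Separator.S Sep e × EvidencedFrame._─[_]→_ 𝒜 D (EvidencedFrame.⊤ₚ 𝒜 D) e (EvidencedFrame.⊥ₚ 𝒜 D)))
      ⇔ CompleteHeytingPrealgebra._≤_ H (CompleteHeytingPrealgebra.𝟏 H) (CompleteHeytingPrealgebra.𝟎 H)
theorem3 Mo 𝒜 H D Sep = mk⇔
  (λ (e , Se , ⊤→⊥) → ─→⊥ₚ-refutes 𝒜 D Sep Se Se ⊤→⊥)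
  (λ 𝟏≤𝟎 → MCA.lam 𝒜 zero (var zero) , S-identity 𝒜 D Sep , inconsistent⇒─→ 𝒜 D 𝟏≤𝟎 _ _ _)
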